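{- Let $m\geq 3$ be an integer. Consider $C_m[4]$ with vertex set $\{(a,i): a\in\{0,1,2,3\},\ i\in\mathbb{Z}_m\}$, and for each $i\in\mathbb{Z}_m$ add the complete graph $K_4$ on the four vertices $(0,i),(1,i),(2,i),(3,i)$; call the resulting graph $C_m[4]\oplus mK_4$. Then there is a $1$-factor $I$ of $C_m[4]$ such that $(C_m[4]-I)\oplus mK_4$ has a $\{C_4^2,C_m^3\}$-factorization, i.e. its edge set can be partitioned into two $C_4$-factors and three $C_m$-factors.
   Context: For a graph $G$ and integer $k\geq 1$, $G[k]$ denotes the graph with vertex set $V(G)\times\{0,1,\dots,k-1\}$ (written here with the copy index first) in which two vertices are adjacent if and only if their $G$-coordinates are adjacent in $G$; thus $C_m[4]$ has $(a,i)\sim(b,j)$ iff $j=i\pm1$ in $\mathbb{Z}_m$. A $1$-factor is a perfect matching. A $C_\ell$-factor of a graph is a spanning subgraph that is a vertex-disjoint union of $\ell$-cycles. -}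

module Defs where

open import Data.Nat using (ℕ; suc; _<_)
open import Data.Fin using (Fin; toℕ)
import Data.Fin as Fin
open import Data.Product using (_×_; Σ; ∃; ∃-syntax; _,_)
open import Data.Sum using (_⊎_)
open import Relation.Binary.PropositionalEquality using (_≡_; _≢_)
open import Relation.Nullary using (¬_)

Succ : (m : ℕ) → Fin m → Fin m → Set
Succ m i j = (toℕ j ≡ suc (toℕ i)) ⊎ ((suc (toℕ i) ≡ m) × (toℕ j ≡ 0))

Graph : Set → Set₁
Graph V = V → V → Set

Vtx : ℕ → Set
Vtx m = Fin 4 × Fin m

Cm4 : (m : ℕ) → Graph (Vtx m)
Cm4 m (a , i) (b , j) = Succ m i j ⊎ Succ m j i

mK4 : (m : ℕ) → Graph (Vtx m)
mK4 m (a , i) (b , j) = (i ≡ j) × (a ≢ b)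

-- A 1-factor (perfect matching) of a graph G, given as its partner map:
-- every vertex v is matched to exactly one vertex partner v, with
-- {v , partner v} an edge of G.
record OneFactor {V : Set} (G : Graph V) : Set where
  field
    partner    : V → V
    involutive : ∀ v → partner (partner v) ≡ v
    isEdge     : ∀ v → G v (partner v)

MEdge : {V : Set} {G : Graph V} → OneFactor G → Graph V
MEdge I u v = v ≡ OneFactor.partner I u

Minus : {V : Set} → Graph V → Graph V → Graph V
Minus G I u v = G u v × ¬ I u v

Oplus : {V : Set} → Graph V → Graph V → Graph V
Oplus G H u v = G u v ⊎ H u v

-- Given by t cycles cyc k : Fin ℓ → V (cycle k visits cyc k 0, cyc k 1, …,
-- cyc k (ℓ-1), back to cyc k 0); the vertices cyc k i are pairwise distinct
-- over all (k , i) and cover V.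
record CycleFactor (V : Set) (ℓ : ℕ) : Set where
  field
    t      : ℕ
    cyc    : Fin t → Fin ℓ → V
    cover  : ∀ v → ∃[ k ] ∃[ i ] cyc k i ≡ v
    disj   : ∀ k i k′ i′ → cyc k i ≡ cyc k′ i′ → (k ≡ k′) × (i ≡ i′)

CEdge : {V : Set} {ℓ : ℕ} → CycleFactor V ℓ → Graph V
CEdge {ℓ = ℓ} F u v =
  ∃[ k ] ∃[ i ] ∃[ i′ ] Succ ℓ i i′ ×
    (((u ≡ CycleFactor.cyc F k i) × (v ≡ CycleFactor.cyc F k i′)) ⊎
     ((v ≡ CycleFactor.cyc F k i) × (u ≡ CycleFactor.cyc F k i′)))

EdgePartition : {V : Set} {n : ℕ} → Graph V → (Fin n → Graph V) → Set
EdgePartition {V} {n} G F =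
  (∀ u v → G u v → ∃[ j ] F j u v) ×
  (∀ j u v → F j u v → G u v) ×
  (∀ j j′ u v → F j u v → F j′ u v → j ≡ j′)

five : {V : Set} → Graph V → Graph V → Graph V → Graph V → Graph V → Fin 5 → Graph V
five g₀ g₁ g₂ g₃ g₄ Fin.zero = g₀
five g₀ g₁ g₂ g₃ g₄ (Fin.suc Fin.zero) = g₁
five g₀ g₁ g₂ g₃ g₄ (Fin.suc (Fin.suc Fin.zero)) = g₂
five g₀ g₁ g₂ g₃ g₄ (Fin.suc (Fin.suc (Fin.suc Fin.zero))) = g₃
five g₀ g₁ g₂ g₃ g₄ (Fin.suc (Fin.suc (Fin.suc (Fin.suc Fin.zero)))) = g₄

record C4²Cm³Factorization {V : Set} (m : ℕ) (G : Graph V) : Set where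
  field
    A₀ A₁    : CycleFactor V 4
    B₀ B₁ B₂ : CycleFactor V m
    partition : EdgePartition G
                  (five (CEdge A₀) (CEdge A₁) (CEdge B₀) (CEdge B₁) (CEdge B₂))

-- Write (a , i) for copy a on level i. The 1-factor I matches (0,i), (1,i) with (2,i+1), (3,i+1).
-- Of the other edges between consecutive levels, those whose copies differ by 2 (mod 4) are the
-- rungs (2,i)(0,i+1) and (3,i)(1,i+1); with the K₄-edges 01 and 23 they form the ladder 4-cycles
-- (2,i)(3,i)(1,i+1)(0,i+1), and the remaining K₄-edges form the 4-cycle 0 2 1 3 on every level.
-- The twelve edges with difference 0, 1 or 3 form three C_m-factors, the spirals: cycle k of
-- spiral c visits copy k + offset on every level, where the offset depends on c and on the parity
-- of the level (with an exceptional last level when m is odd), chosen so that across every step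
-- the three spirals advance by 0, 1 and 3 in some order. Every edge of the resulting graph then
-- has a unique colour, naming the factor that contains it.

module Submission where

open import Defs
open import Data.Bool using (Bool; true; false; not)
open import Data.Empty using (⊥-elim)
open import Data.Fin using (Fin; zero; suc; toℕ; fromℕ; inject₁; lower₁; _↑ʳ_)
open import Data.Fin.Patterns using (0F; 1F; 2F; 3F; 4F)
open import Data.Fin.Properties using (_≟_; toℕ-injective; toℕ<n; toℕ-fromℕ; toℕ-inject₁; toℕ-lower₁; all?; any?)
open import Data.Nat using (ℕ; zero; suc; _+_; _∸_; _≤_; s≤s; z≤n)
import Data.Nat.Properties as ℕ
open import Data.Nat.DivMod using (_mod_)
open import Data.Product using (_×_; Σ; _,_; ∃-syntax; proj₁; proj₂)
open import Data.Sum using (_⊎_; inj₁; inj₂)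
open import Function using (_∘_)
open import Relation.Binary.PropositionalEquality using (_≡_; _≢_; refl; sym; trans; cong; subst)
open import Relation.Nullary using (¬_; yes; no)
open import Relation.Nullary.Decidable using (Dec; does; from-yes; dec-true; dec-false; map′; ¬?; _×-dec_; _→-dec_)

next : ∀ {n} → Fin (suc n) → Fin (suc n)
next {n} i with n ℕ.≟ toℕ i
... | yes _   = zero
... | no  n≢i = suc (lower₁ i n≢i)

prev : ∀ {n} → Fin (suc n) → Fin (suc n)
prev {n} zero    = fromℕ n
prev     (suc i) = inject₁ i

Succ-next : ∀ {n} (i : Fin (suc n)) → Succ (suc n) i (next i)
Succ-next {n} i with n ℕ.≟ toℕ i
... | yes n≡i = inj₂ (cong suc (sym n≡i) , refl)
... | no  n≢i = inj₁ (cong suc (toℕ-lower₁ i n≢i))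

Succ-prev : ∀ {n} (i : Fin (suc n)) → Succ (suc n) (prev i) i
Succ-prev {n} zero    = inj₂ (cong suc (toℕ-fromℕ n) , refl)
Succ-prev     (suc i) = inj₁ (cong suc (sym (toℕ-inject₁ i)))

Succ-functional : ∀ {m} {i j j′ : Fin m} → Succ m i j → Succ m i j′ → j ≡ j′
Succ-functional (inj₁ j≡1+i) (inj₁ j′≡1+i) = toℕ-injective (trans j≡1+i (sym j′≡1+i))
Succ-functional {j = j}  (inj₁ j≡1+i) (inj₂ (1+i≡m , _)) = ⊥-elim (ℕ.<-irrefl (trans j≡1+i 1+i≡m) (toℕ<n j))
Succ-functional {j′ = j′} (inj₂ (1+i≡m , _)) (inj₁ j′≡1+i) = ⊥-elim (ℕ.<-irrefl (trans j′≡1+i 1+i≡m) (toℕ<n j′))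
Succ-functional (inj₂ (_ , j≡0)) (inj₂ (_ , j′≡0)) = toℕ-injective (trans j≡0 (sym j′≡0))

Succ-injective : ∀ {m} {i i′ j : Fin m} → Succ m i j → Succ m i′ j → i ≡ i′
Succ-injective (inj₁ e) (inj₁ e′) = toℕ-injective (ℕ.suc-injective (trans (sym e) e′))
Succ-injective (inj₁ e) (inj₂ (_ , e′)) with trans (sym e) e′
... | ()
Succ-injective (inj₂ (_ , e)) (inj₁ e′) with trans (sym e′) e
... | ()
Succ-injective (inj₂ (e , _)) (inj₂ (e′ , _)) = toℕ-injective (ℕ.suc-injective (trans e (sym e′)))

Succ⇒≡next : ∀ {n} {i j : Fin (suc n)} → Succ (suc n) i j → j ≡ next i
Succ⇒≡next {i = i} s = Succ-functional s (Succ-next i)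

Succ⇒≡prev : ∀ {n} {i j : Fin (suc n)} → Succ (suc n) i j → i ≡ prev j
Succ⇒≡prev {j = j} s = Succ-injective s (Succ-prev j)

prev-next : ∀ {n} (i : Fin (suc n)) → prev (next i) ≡ i
prev-next i = sym (Succ⇒≡prev (Succ-next i))

next-prev : ∀ {n} (i : Fin (suc n)) → next (prev i) ≡ i
next-prev i = sym (Succ⇒≡next (Succ-prev i))

next-injective : ∀ {n} {i i′ : Fin (suc n)} → next i ≡ next i′ → i ≡ i′
next-injective {i = i} {i′} e = trans (sym (prev-next i)) (trans (cong prev e) (prev-next i′))

Succ-irrefl : ∀ {n} {i : Fin (suc (suc n))} → ¬ Succ (suc (suc n)) i i
Succ-irrefl (inj₁ i≡1+i) = ℕ.1+n≢n (sym i≡1+i)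
Succ-irrefl (inj₂ (1+i≡m , i≡0)) rewrite i≡0 with 1+i≡m
... | ()

Succ-asym : ∀ {n} {i j : Fin (suc (suc (suc n)))} → Succ _ i j → ¬ Succ _ j i
Succ-asym (inj₁ j≡1+i) (inj₁ i≡1+j) = ℕ.m≢1+n+m _ (trans i≡1+j (cong suc j≡1+i))
Succ-asym (inj₁ j≡1+i) (inj₂ (1+j≡m , i≡0)) rewrite i≡0 | j≡1+i with 1+j≡m
... | ()
Succ-asym (inj₂ (1+i≡m , j≡0)) (inj₁ i≡1+j) rewrite j≡0 | i≡1+j with 1+i≡m
... | ()
Succ-asym (inj₂ (_ , j≡0)) (inj₂ (1+j≡m , _)) rewrite j≡0 with 1+j≡m
... | ()

infixl 6 _⊕_ _⊖_

_⊕_ : Fin 4 → Fin 4 → Fin 4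
a ⊕ b = (toℕ a + toℕ b) mod 4

_⊖_ : Fin 4 → Fin 4 → Fin 4
a ⊖ b = (toℕ a + (4 ∸ toℕ b)) mod 4

⊖-⊕-cancel : ∀ a b → a ⊖ b ⊕ b ≡ a
⊖-⊕-cancel = from-yes (all? λ a → all? λ b → a ⊖ b ⊕ b ≟ a)

⊕-cancelʳ : ∀ a a′ b → a ⊕ b ≡ a′ ⊕ b → a ≡ a′
⊕-cancelʳ = from-yes (all? λ a → all? λ a′ → all? λ b → (a ⊕ b ≟ a′ ⊕ b) →-dec (a ≟ a′))

⊕-⊖-translate : ∀ k x y → (k ⊕ y) ⊖ (k ⊕ x) ≡ y ⊖ x
⊕-⊖-translate = from-yes (all? λ k → all? λ x → all? λ y → (k ⊕ y) ⊖ (k ⊕ x) ≟ y ⊖ x)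

⊖-⊕-transfer : ∀ a b x y → b ⊖ a ≡ y ⊖ x → a ⊖ x ⊕ y ≡ b
⊖-⊕-transfer = from-yes (all? λ a → all? λ b → all? λ x → all? λ y → (b ⊖ a ≟ y ⊖ x) →-dec (a ⊖ x ⊕ y ≟ b))

⊖≡⇒≡⊕ : ∀ a b d → b ⊖ a ≡ d → b ≡ a ⊕ d
⊖≡⇒≡⊕ = from-yes (all? λ a → all? λ b → all? λ d → (b ⊖ a ≟ d) →-dec (b ≟ a ⊕ d))

-- `last` is level m − 1 for odd m, which would otherwise be an even level followed by level 0.
data LevelKind : Set where
  even odd last : LevelKind

data KindStep : LevelKind → LevelKind → Set where
  even-odd  : KindStep even odd
  odd-even  : KindStep odd even
  odd-last  : KindStep odd last
  last-even : KindStep last even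

isEven : ℕ → Bool
isEven zero    = true
isEven (suc k) = not (isEven k)

kindOf : (isEven isLast : Bool) → LevelKind
kindOf true  true  = last
kindOf true  false = even
kindOf false _     = odd

levelKind : (m k : ℕ) → LevelKind
levelKind m k = kindOf (isEven k) (does (suc k ℕ.≟ m))

kindOf-step : ∀ e l → KindStep (kindOf e false) (kindOf (not e) l)
kindOf-step true  _     = even-odd
kindOf-step false true  = odd-last
kindOf-step false false = odd-even

kindOf-wrap : ∀ e → KindStep (kindOf e true) even
kindOf-wrap true  = last-even
kindOf-wrap false = odd-even

levelKind-step : ∀ {m} k → suc k ≢ m → KindStep (levelKind m k) (levelKind m (suc k))
levelKind-step {m} k 1+k≢m rewrite dec-false (suc k ℕ.≟ m) 1+k≢m = kindOf-step (isEven k) _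

levelKind-wrap : ∀ {m} k → suc k ≡ m → KindStep (levelKind m k) even
levelKind-wrap {m} k 1+k≡m rewrite dec-true (suc k ℕ.≟ m) 1+k≡m = kindOf-wrap (isEven k)

kind : ∀ {m} → Fin m → LevelKind
kind {m} i = levelKind m (toℕ i)

kind-step : ∀ {n} {i j : Fin (suc (suc (suc n)))} → Succ _ i j → KindStep (kind i) (kind j)
kind-step {n} {i} {j} (inj₁ j≡1+i) =
  subst (λ k → KindStep (kind i) (levelKind (suc (suc (suc n))) k)) (sym j≡1+i)
    (levelKind-step (toℕ i) λ 1+i≡m → ℕ.<-irrefl (trans j≡1+i 1+i≡m) (toℕ<n j))
kind-step {i = i} (inj₂ (1+i≡m , j≡0)) rewrite toℕ-injective {j = 0F} j≡0 = levelKind-wrap (toℕ i) 1+i≡m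

offset : LevelKind → Fin 3 → Fin 4
offset even _  = 0F
offset odd  0F = 0F
offset odd  1F = 1F
offset odd  2F = 3F
offset last 0F = 1F
offset last 1F = 0F
offset last 2F = 3F

shift : LevelKind → LevelKind → Fin 3 → Fin 4
shift s t c = offset t c ⊖ offset s c

record IsShiftBijection (d : Fin 3 → Fin 4) : Set where
  field
    avoids-2  : ∀ c → d c ≢ 2F
    injective : ∀ c c′ → d c ≡ d c′ → c ≡ c′
    onto      : ∀ δ → δ ≢ 2F → ∃[ c ] d c ≡ δ

isShiftBijection? : ∀ d → Dec (IsShiftBijection d)
isShiftBijection? d =
  map′ (λ (a , i , o) → record { avoids-2 = a ; injective = i ; onto = o })
       (λ b → let open IsShiftBijection b in avoids-2 , injective , onto)
       (    all? (λ c → ¬? (d c ≟ 2F))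
      ×-dec all? (λ c → all? λ c′ → (d c ≟ d c′) →-dec (c ≟ c′))
      ×-dec all? (λ δ → ¬? (δ ≟ 2F) →-dec any? λ c → d c ≟ δ))

step-shiftBijection : ∀ {s t} → KindStep s t → IsShiftBijection (shift s t)
step-shiftBijection even-odd  = from-yes (isShiftBijection? (shift even odd))
step-shiftBijection odd-even  = from-yes (isShiftBijection? (shift odd even))
step-shiftBijection odd-last  = from-yes (isShiftBijection? (shift odd last))
step-shiftBijection last-even = from-yes (isShiftBijection? (shift last even))

CEdge-sym : ∀ {V ℓ} (F : CycleFactor V ℓ) {u v} → CEdge F u v → CEdge F v u
CEdge-sym F (k , r , r′ , s , inj₁ uv) = k , r , r′ , s , inj₂ uv
CEdge-sym F (k , r , r′ , s , inj₂ vu) = k , r , r′ , s , inj₁ vu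

CEdge⊆ : ∀ {V ℓ} (F : CycleFactor V ℓ) {R : Graph V} → (∀ {u v} → R u v → R v u) →
         (∀ k r r′ → Succ ℓ r r′ → R (CycleFactor.cyc F k r) (CycleFactor.cyc F k r′)) →
         ∀ {u v} → CEdge F u v → R u v
CEdge⊆ F R-sym step (k , r , r′ , s , inj₁ (refl , refl)) = step k r r′ s
CEdge⊆ F R-sym step (k , r , r′ , s , inj₂ (refl , refl)) = R-sym (step k r r′ s)

edgePartition-byColouring :
  ∀ {V n} {G : Graph V} {F Coloured : Fin n → Graph V} →
  (∀ u v → G u v → ∃[ j ] F j u v) →
  (∀ j {u v} → F j u v → Coloured j u v) →
  (∀ j {u v} → Coloured j u v → G u v) →
  (∀ j j′ {u v} → Coloured j u v → Coloured j′ u v → j ≡ j′) →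
  EdgePartition G F
edgePartition-byColouring cover F⊆C C⊆G C-functional =
    cover
  , (λ j u v → C⊆G j ∘ F⊆C j)
  , (λ j j′ u v e e′ → C-functional j j′ (F⊆C j e) (F⊆C j′ e′))

intraColour : Fin 4 → Fin 4 → Fin 5
intraColour 0F 1F = 1F
intraColour 1F 0F = 1F
intraColour 2F 3F = 1F
intraColour 3F 2F = 1F
intraColour _  _  = 0F

intraColour-comm : ∀ a b → intraColour a b ≡ intraColour b a
intraColour-comm = from-yes (all? λ a → all? λ b → intraColour a b ≟ intraColour b a)

-- The factor containing the edge from (a , i) up to (b , i+1), numbered as in factorEdges;
-- the edges of I have no colour.
data UpColour (s t : LevelKind) : Fin 4 → Fin 4 → Fin 5 → Set where
  rung₂  : UpColour s t 2F 0F 1F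
  rung₃  : UpColour s t 3F 1F 1F
  spiral : ∀ {a b} c → b ⊖ a ≡ shift s t c → UpColour s t a b (2 ↑ʳ c)

UpColour-functional : ∀ {s t a b j j′} → IsShiftBijection (shift s t) →
                      UpColour s t a b j → UpColour s t a b j′ → j ≡ j′
UpColour-functional bij rung₂        rung₂         = refl
UpColour-functional bij rung₃        rung₃         = refl
UpColour-functional bij rung₂        (spiral c d)  = ⊥-elim (IsShiftBijection.avoids-2 bij c (sym d))
UpColour-functional bij rung₃        (spiral c d)  = ⊥-elim (IsShiftBijection.avoids-2 bij c (sym d))
UpColour-functional bij (spiral c d) rung₂         = ⊥-elim (IsShiftBijection.avoids-2 bij c (sym d))
UpColour-functional bij (spiral c d) rung₃         = ⊥-elim (IsShiftBijection.avoids-2 bij c (sym d))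
UpColour-functional bij (spiral c d) (spiral c′ d′) =
  cong (2 ↑ʳ_) (IsShiftBijection.injective bij c c′ (trans (sym d) d′))

module Construction (n : ℕ) where

  m : ℕ
  m = suc (suc (suc n))

  V : Set
  V = Vtx m

  partner : V → V
  partner (0F , i) = (2F , next i)
  partner (1F , i) = (3F , next i)
  partner (2F , i) = (0F , prev i)
  partner (3F , i) = (1F , prev i)

  partner-involutive : ∀ v → partner (partner v) ≡ v
  partner-involutive (0F , i) = cong (0F ,_) (prev-next i)
  partner-involutive (1F , i) = cong (1F ,_) (prev-next i)
  partner-involutive (2F , i) = cong (2F ,_) (next-prev i)
  partner-involutive (3F , i) = cong (3F ,_) (next-prev i)

  partner-flip : ∀ {u v} → v ≡ partner u → u ≡ partner v
  partner-flip {u} refl = sym (partner-involutive u)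

  I : OneFactor (Cm4 m)
  I = record { partner = partner ; involutive = partner-involutive ; isEdge = isEdge }
    where
    isEdge : ∀ v → Cm4 m v (partner v)
    isEdge (0F , i) = inj₁ (Succ-next i)
    isEdge (1F , i) = inj₁ (Succ-next i)
    isEdge (2F , i) = inj₂ (Succ-prev i)
    isEdge (3F , i) = inj₂ (Succ-prev i)

  G : Graph V
  G = Oplus (Minus (Cm4 m) (MEdge I)) (mK4 m)

  ring : Fin 4 → Fin 4
  ring 0F = 0F
  ring 1F = 2F
  ring 2F = 1F
  ring 3F = 3F

  ring-involutive : ∀ r → ring (ring r) ≡ r
  ring-involutive = from-yes (all? λ r → ring (ring r) ≟ r)

  levelCycles : CycleFactor V 4
  levelCycles = record
    { t = m ; cyc = λ i r → (ring r , i)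
    ; cover = λ { (a , i) → i , ring a , cong (_, i) (ring-involutive a) }
    ; disj = λ i r i′ r′ e → cong proj₂ e , ring-injective (cong proj₁ e) }
    where
    ring-injective : ∀ {r r′} → ring r ≡ ring r′ → r ≡ r′
    ring-injective {r} {r′} e = trans (sym (ring-involutive r)) (trans (cong ring e) (ring-involutive r′))

  ladder : Fin m → Fin 4 → V
  ladder i 0F = (2F , i)
  ladder i 1F = (3F , i)
  ladder i 2F = (1F , next i)
  ladder i 3F = (0F , next i)

  ladder-disjoint : ∀ k r k′ r′ → ladder k r ≡ ladder k′ r′ → (k ≡ k′) × (r ≡ r′)
  ladder-disjoint k 0F k′ 0F refl = refl , refl
  ladder-disjoint k 1F k′ 1F refl = refl , refl
  ladder-disjoint k 2F k′ 2F e    = next-injective (cong proj₂ e) , refl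
  ladder-disjoint k 3F k′ 3F e    = next-injective (cong proj₂ e) , refl
  ladder-disjoint k 0F k′ 1F ()
  ladder-disjoint k 0F k′ 2F ()
  ladder-disjoint k 0F k′ 3F ()
  ladder-disjoint k 1F k′ 0F ()
  ladder-disjoint k 1F k′ 2F ()
  ladder-disjoint k 1F k′ 3F ()
  ladder-disjoint k 2F k′ 0F ()
  ladder-disjoint k 2F k′ 1F ()
  ladder-disjoint k 2F k′ 3F ()
  ladder-disjoint k 3F k′ 0F ()
  ladder-disjoint k 3F k′ 1F ()
  ladder-disjoint k 3F k′ 2F ()

  ladder-cover : ∀ v → ∃[ k ] ∃[ r ] ladder k r ≡ v
  ladder-cover (0F , i) = prev i , 3F , cong (0F ,_) (next-prev i)
  ladder-cover (1F , i) = prev i , 2F , cong (1F ,_) (next-prev i)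
  ladder-cover (2F , i) = i , 0F , refl
  ladder-cover (3F , i) = i , 1F , refl

  ladderCycles : CycleFactor V 4
  ladderCycles = record { t = m ; cyc = ladder ; cover = ladder-cover ; disj = ladder-disjoint }

  spiralCycle : Fin 3 → Fin 4 → Fin m → V
  spiralCycle c k i = (k ⊕ offset (kind i) c , i)

  spiralCycles : Fin 3 → CycleFactor V m
  spiralCycles c = record
    { t = 4 ; cyc = spiralCycle c
    ; cover = λ { (a , i) → a ⊖ offset (kind i) c , i , cong (_, i) (⊖-⊕-cancel a _) }
    ; disj = disjoint }
    where
    disjoint : ∀ k i k′ i′ → spiralCycle c k i ≡ spiralCycle c k′ i′ → (k ≡ k′) × (i ≡ i′)
    disjoint k i k′ i′ e with cong proj₂ e
    ... | refl = ⊕-cancelʳ k k′ _ (cong proj₁ e) , refl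

  factorEdges : Fin 5 → Graph V
  factorEdges = five (CEdge levelCycles) (CEdge ladderCycles)
                     (CEdge (spiralCycles 0F)) (CEdge (spiralCycles 1F)) (CEdge (spiralCycles 2F))

  Coloured : Fin 5 → Graph V
  Coloured j (a , i) (b , i′) =
      (i ≡ i′ × a ≢ b × intraColour a b ≡ j)
    ⊎ (Succ m i i′ × UpColour (kind i) (kind i′) a b j)
    ⊎ (Succ m i′ i × UpColour (kind i′) (kind i) b a j)

  Coloured-sym : ∀ j {u v} → Coloured j u v → Coloured j v u
  Coloured-sym j {a , _} {b , _} (inj₁ (refl , a≢b , col)) =
    inj₁ (refl , a≢b ∘ sym , trans (intraColour-comm b a) col)
  Coloured-sym j (inj₂ (inj₁ up))   = inj₂ (inj₂ up)
  Coloured-sym j (inj₂ (inj₂ down)) = inj₂ (inj₁ down)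

  Coloured-functional : ∀ j j′ {u v} → Coloured j u v → Coloured j′ u v → j ≡ j′
  Coloured-functional j j′ (inj₁ (_ , _ , col)) (inj₁ (_ , _ , col′)) = trans (sym col) col′
  Coloured-functional j j′ (inj₁ (refl , _)) (inj₂ (inj₁ (s , _))) = ⊥-elim (Succ-irrefl s)
  Coloured-functional j j′ (inj₁ (refl , _)) (inj₂ (inj₂ (s , _))) = ⊥-elim (Succ-irrefl s)
  Coloured-functional j j′ (inj₂ (inj₁ (s , _))) (inj₁ (refl , _)) = ⊥-elim (Succ-irrefl s)
  Coloured-functional j j′ (inj₂ (inj₂ (s , _))) (inj₁ (refl , _)) = ⊥-elim (Succ-irrefl s)
  Coloured-functional j j′ (inj₂ (inj₁ (s , up))) (inj₂ (inj₁ (_ , up′))) =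
    UpColour-functional (step-shiftBijection (kind-step s)) up up′
  Coloured-functional j j′ (inj₂ (inj₂ (s , up))) (inj₂ (inj₂ (_ , up′))) =
    UpColour-functional (step-shiftBijection (kind-step s)) up up′
  Coloured-functional j j′ (inj₂ (inj₁ (s , _))) (inj₂ (inj₂ (s′ , _))) = ⊥-elim (Succ-asym s s′)
  Coloured-functional j j′ (inj₂ (inj₂ (s , _))) (inj₂ (inj₁ (s′ , _))) = ⊥-elim (Succ-asym s s′)

  UpColour⇒¬I : ∀ {j} a b i i′ → Succ m i i′ → UpColour (kind i) (kind i′) a b j → (b , i′) ≢ partner (a , i)
  UpColour⇒¬I 0F _ i _ s (spiral c d) refl = IsShiftBijection.avoids-2 (step-shiftBijection (kind-step s)) c (sym d)
  UpColour⇒¬I 1F _ i _ s (spiral c d) refl = IsShiftBijection.avoids-2 (step-shiftBijection (kind-step s)) c (sym d)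
  UpColour⇒¬I 2F _ i _ s _ refl = Succ-asym (Succ-prev i) s
  UpColour⇒¬I 3F _ i _ s _ refl = Succ-asym (Succ-prev i) s

  Coloured⇒G : ∀ j {u v} → Coloured j u v → G u v
  Coloured⇒G j (inj₁ (i≡i′ , a≢b , _)) = inj₂ (i≡i′ , a≢b)
  Coloured⇒G j {a , i} {b , i′} (inj₂ (inj₁ (s , up))) = inj₁ (inj₁ s , UpColour⇒¬I a b i i′ s up)
  Coloured⇒G j {a , i} {b , i′} (inj₂ (inj₂ (s , down))) =
    inj₁ (inj₂ s , UpColour⇒¬I b a i′ i s down ∘ partner-flip)

  levelCycles-coloured : ∀ i r r′ → Succ 4 r r′ → Coloured 0F (ring r , i) (ring r′ , i)
  levelCycles-coloured i r r′ s rewrite Succ⇒≡next s = inj₁ (refl , ring-step r)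
    where
    ring-step : ∀ r → ring r ≢ ring (next r) × intraColour (ring r) (ring (next r)) ≡ 0F
    ring-step = from-yes (all? λ r → ¬? (ring r ≟ ring (next r)) ×-dec (intraColour (ring r) (ring (next r)) ≟ 0F))

  ladderCycles-coloured : ∀ k r r′ → Succ 4 r r′ → Coloured 1F (ladder k r) (ladder k r′)
  ladderCycles-coloured k r r′ s rewrite Succ⇒≡next s = rung r
    where
    rung : ∀ r → Coloured 1F (ladder k r) (ladder k (next r))
    rung 0F = inj₁ (refl , (λ ()) , refl)
    rung 1F = inj₂ (inj₁ (Succ-next k , rung₃))
    rung 2F = inj₁ (refl , (λ ()) , refl)
    rung 3F = inj₂ (inj₂ (Succ-next k , rung₂))

  spiralCycles-coloured : ∀ c k i i′ → Succ m i i′ → Coloured (2 ↑ʳ c) (spiralCycle c k i) (spiralCycle c k i′)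
  spiralCycles-coloured c k i i′ s = inj₂ (inj₁ (s , spiral c (⊕-⊖-translate k _ _)))

  factorEdges-coloured : ∀ j {u v} → factorEdges j u v → Coloured j u v
  factorEdges-coloured 0F = CEdge⊆ levelCycles (Coloured-sym 0F) levelCycles-coloured
  factorEdges-coloured 1F = CEdge⊆ ladderCycles (Coloured-sym 1F) ladderCycles-coloured
  factorEdges-coloured 2F = CEdge⊆ (spiralCycles 0F) (Coloured-sym 2F) (spiralCycles-coloured 0F)
  factorEdges-coloured 3F = CEdge⊆ (spiralCycles 1F) (Coloured-sym 3F) (spiralCycles-coloured 1F)
  factorEdges-coloured 4F = CEdge⊆ (spiralCycles 2F) (Coloured-sym 4F) (spiralCycles-coloured 2F)

  factorEdges-sym : ∀ j {u v} → factorEdges j u v → factorEdges j v u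
  factorEdges-sym 0F = CEdge-sym levelCycles
  factorEdges-sym 1F = CEdge-sym ladderCycles
  factorEdges-sym 2F = CEdge-sym (spiralCycles 0F)
  factorEdges-sym 3F = CEdge-sym (spiralCycles 1F)
  factorEdges-sym 4F = CEdge-sym (spiralCycles 2F)

  spiralEdge : ∀ c {u v} → CEdge (spiralCycles c) u v → factorEdges (2 ↑ʳ c) u v
  spiralEdge 0F e = e
  spiralEdge 1F e = e
  spiralEdge 2F e = e

  ringEdge : ∀ i r → factorEdges 0F (ring r , i) (ring (next r) , i)
  ringEdge i r = i , r , next r , Succ-next r , inj₁ (refl , refl)

  ladderEdge : ∀ k r → factorEdges 1F (ladder k r) (ladder k (next r))
  ladderEdge k r = k , r , next r , Succ-next r , inj₁ (refl , refl)

  lowerRungEdge : ∀ i → factorEdges 1F (1F , i) (0F , i)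
  lowerRungEdge i = subst (λ i → factorEdges 1F (1F , i) (0F , i)) (next-prev i) (ladderEdge (prev i) 2F)

  intraCover : ∀ a b i → a ≢ b → ∃[ j ] factorEdges j (a , i) (b , i)
  intraCover 0F 2F i _ = 0F , ringEdge i 0F
  intraCover 2F 1F i _ = 0F , ringEdge i 1F
  intraCover 1F 3F i _ = 0F , ringEdge i 2F
  intraCover 3F 0F i _ = 0F , ringEdge i 3F
  intraCover 2F 0F i _ = 0F , factorEdges-sym 0F (ringEdge i 0F)
  intraCover 1F 2F i _ = 0F , factorEdges-sym 0F (ringEdge i 1F)
  intraCover 3F 1F i _ = 0F , factorEdges-sym 0F (ringEdge i 2F)
  intraCover 0F 3F i _ = 0F , factorEdges-sym 0F (ringEdge i 3F)
  intraCover 2F 3F i _ = 1F , ladderEdge i 0F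
  intraCover 3F 2F i _ = 1F , factorEdges-sym 1F (ladderEdge i 0F)
  intraCover 1F 0F i _ = 1F , lowerRungEdge i
  intraCover 0F 1F i _ = 1F , factorEdges-sym 1F (lowerRungEdge i)
  intraCover 0F 0F i a≢a = ⊥-elim (a≢a refl)
  intraCover 1F 1F i a≢a = ⊥-elim (a≢a refl)
  intraCover 2F 2F i a≢a = ⊥-elim (a≢a refl)
  intraCover 3F 3F i a≢a = ⊥-elim (a≢a refl)

  rungCover : ∀ a {b} i i′ → Succ m i i′ → b ≡ a ⊕ 2F → (b , i′) ≢ partner (a , i) →
              ∃[ j ] factorEdges j (a , i) (b , i′)
  rungCover 0F i i′ s refl ¬I = ⊥-elim (¬I (cong (2F ,_) (Succ⇒≡next s)))
  rungCover 1F i i′ s refl ¬I = ⊥-elim (¬I (cong (3F ,_) (Succ⇒≡next s)))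
  rungCover 2F i i′ s refl _ rewrite Succ⇒≡next s = 1F , factorEdges-sym 1F (ladderEdge i 3F)
  rungCover 3F i i′ s refl _ rewrite Succ⇒≡next s = 1F , ladderEdge i 1F

  upCover : ∀ a b i i′ → Succ m i i′ → (b , i′) ≢ partner (a , i) → ∃[ j ] factorEdges j (a , i) (b , i′)
  upCover a b i i′ s ¬I with b ⊖ a ≟ 2F
  ... | yes δ≡2 = rungCover a i i′ s (⊖≡⇒≡⊕ a b 2F δ≡2) ¬I
  ... | no  δ≢2 with IsShiftBijection.onto (step-shiftBijection (kind-step s)) (b ⊖ a) δ≢2
  ...   | c , shift≡δ = 2 ↑ʳ c , spiralEdge c
            (a ⊖ offset (kind i) c , i , i′ , s ,
             inj₁ (cong (_, i) (sym (⊖-⊕-cancel a _)) , cong (_, i′) (sym (⊖-⊕-transfer a b (offset (kind i) c) _ (sym shift≡δ)))))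

  cover : ∀ u v → G u v → ∃[ j ] factorEdges j u v
  cover (a , i) (b , i′) (inj₁ (inj₁ s , ¬I)) = upCover a b i i′ s ¬I
  cover (a , i) (b , i′) (inj₁ (inj₂ s , ¬I)) with upCover b a i′ i s (¬I ∘ partner-flip)
  ... | j , e = j , factorEdges-sym j e
  cover (a , i) (b , i′) (inj₂ (refl , a≢b)) = intraCover a b i a≢b

  factorization : C4²Cm³Factorization m G
  factorization = record
    { A₀ = levelCycles ; A₁ = ladderCycles
    ; B₀ = spiralCycles 0F ; B₁ = spiralCycles 1F ; B₂ = spiralCycles 2F
    ; partition = edgePartition-byColouring cover factorEdges-coloured Coloured⇒G Coloured-functional }

lemma10 : (m : ℕ) → 3 ≤ m →
    Σ (OneFactor (Cm4 m)) λ I →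
      C4²Cm³Factorization m (Oplus (Minus (Cm4 m) (MEdge I)) (mK4 m))
lemma10 (suc (suc (suc n))) (s≤s (s≤s (s≤s z≤n))) = I , factorization
  where open Construction n
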